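{- Let $m\ge 2$ be a fixed integer. Then, as $n\to\infty$, $b(C(n;1,m))$ is on the order of $\sqrt{n/m}$.
   Context: For an integer $n$ and positive integers $s_1<\dots<s_t\le n/2$, the circulant graph $C(n;s_1,\dots,s_t)$ has vertex set $\mathbb Z_n$, with distinct vertices $x,y$ adjacent iff $x-y \equiv \pm s_i \pmod n$ for some $i$. For a finite connected graph $G$, let $N_\ell[x]=\{y: d(x,y)\le \ell\}$. A sequence of vertices $(x_1,\dots,x_k)$ is a burning sequence of $G$ if $N_{k-1}[x_1]\cup N_{k-2}[x_2]\cup\cdots\cup N_0[x_k]=V(G)$; the burning number $b(G)$ is the minimum length of a burning sequence of $G$. -}

module Defs where

open import Data.Nat using (ℕ; zero; suc; _+_; _*_; _∸_; _≤_; _<_)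
open import Data.Fin using (Fin; toℕ)
open import Data.Vec using (Vec; lookup)
open import Data.List using (List; _∷_; [])
open import Data.List.Relation.Unary.Any using (Any)
open import Data.Product using (Σ; ∃; _×_)
open import Data.Sum using (_⊎_)
open import Relation.Binary.PropositionalEquality using (_≡_; _≢_)
open import Relation.Nullary using (¬_)

ModEq : ℕ → ℕ → ℕ → Set
ModEq n a b = ∃ λ q → (a ≡ b + q * n) ⊎ (b ≡ a + q * n)

-- Circulant graph C(n; S) on vertex set Z_n (represented by Fin n):
-- distinct x, y adjacent iff x - y ≡ ± s (mod n) for some s ∈ S.
CircAdj : (n : ℕ) → List ℕ → Fin n → Fin n → Set
CircAdj n S x y =
  x ≢ y × Any (λ s → ModEq n (toℕ x) (toℕ y + s) ⊎ ModEq n (toℕ y) (toℕ x + s)) S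

-- Within Adj ℓ x y : there is a walk of length ≤ ℓ from x to y, i.e. d(x,y) ≤ ℓ,
-- i.e. y ∈ N_ℓ[x].
data Within {V : Set} (Adj : V → V → Set) : ℕ → V → V → Set where
  here : ∀ {ℓ x} → Within Adj ℓ x x
  step : ∀ {ℓ x y z} → Adj x y → Within Adj ℓ y z → Within Adj (suc ℓ) x z

-- (x_1,…,x_k) is a burning sequence: N_{k-1}[x_1] ∪ … ∪ N_0[x_k] = V.
-- Index i : Fin k corresponds to x_{i+1}, with radius k - 1 - i.
IsBurningSeq : {V : Set} (Adj : V → V → Set) (k : ℕ) → Vec V k → Set
IsBurningSeq {V} Adj k xs =
  ∀ (v : V) → ∃ λ (i : Fin k) → Within Adj (k ∸ suc (toℕ i)) (lookup xs i) v

IsBurningNumber : {V : Set} (Adj : V → V → Set) → ℕ → Set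
IsBurningNumber {V} Adj k =
  (∃ λ (xs : Vec V k) → IsBurningSeq Adj k xs)
  × (∀ j → j < k → ¬ (∃ λ (xs : Vec V j) → IsBurningSeq Adj j xs))

{-# OPTIONS --safe #-}
-- Lower bound: along a walk of length ℓ every step moves by at most ±m, so a
-- vertex within distance ℓ of x lies in the arc x + [-ℓm, ℓm] of ℤ_n. The b
-- arcs of a burning sequence of length b therefore cover at most b(2bm + 1)
-- vertices, whence n ≤ 3mb².
-- Upper bound: if n ≤ mq², write each vertex as i·qm + j·m + a with i, j < q
-- and a < m; burning the centres i·qm first, every vertex is reached by j
-- steps of length m followed by a steps of length 1, so b ≤ 2q + m. For the
-- least such q = p + 1 we have mp² < n; n ≥ m³ gives m ≤ q and n ≥ 2m gives
-- p ≥ 1, so b ≤ 3q ≤ 6p and mb² ≤ 36mp² < 36n.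
module Submission where

open import Defs
open import Data.Nat using (ℕ; _*_; _≤_; _<_)
open import Data.List using (_∷_; [])
open import Data.Product using (Σ; ∃; _×_)
open import Data.Nat using (zero; suc; pred; _+_; _∸_; z≤n; s≤s; z<s; NonZero; >-nonZero⁻¹; _≤?_)
open import Data.Nat.Properties
open import Data.Nat.DivMod using (_%_; _mod_; [m+kn]%n≡m%n; %-distribˡ-+; m<n⇒m%n≡m)
open import Data.Nat.Tactic.RingSolver using (solve)
open import Data.Fin using (Fin; toℕ; fromℕ<; inject≤; _↑ˡ_; combine; quotient; remainder)
open import Data.Fin.Properties
  using (toℕ-injective; toℕ-fromℕ<; toℕ<n; toℕ-inject≤; toℕ-↑ˡ; toℕ-combine; combine-remQuot; combine-injective; injective⇒≤)
open import Data.Vec using (Vec; lookup; tabulate)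
open import Data.Vec.Properties using (lookup∘tabulate)
open import Data.List using (List)
open import Data.List.Membership.Propositional using (_∈_)
open import Data.List.Relation.Unary.All as All using (All; lookupAny)
open import Data.List.Relation.Unary.Any as Any using (here; there)
open import Data.Product using (_,_; proj₁; proj₂; uncurry)
open import Data.Sum using (_⊎_; inj₁; inj₂)
open import Data.Empty using (⊥-elim)
open import Relation.Binary.PropositionalEquality
open import Relation.Nullary using (yes; no)

module _ {V : Set} {Adj : V → V → Set} where

  within-mono : ∀ {ℓ ℓ′ x y} → ℓ ≤ ℓ′ → Within Adj ℓ x y → Within Adj ℓ′ x y
  within-mono _           here       = here
  within-mono (s≤s ℓ≤ℓ′) (step e w) = step e (within-mono ℓ≤ℓ′ w)

  within-trans : ∀ {ℓ ℓ′ x y z} → Within Adj ℓ x y → Within Adj ℓ′ y z → Within Adj (ℓ + ℓ′) x z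
  within-trans {ℓ} {ℓ′} here w′ = within-mono (m≤n+m ℓ′ ℓ) w′
  within-trans (step e w) w′    = step e (within-trans w w′)

module _ {n : ℕ} .{{_ : NonZero n}} where

  ModEq⇒%≡ : ∀ {a b} → ModEq n a b → a % n ≡ b % n
  ModEq⇒%≡ {b = b} (k , inj₁ refl) = [m+kn]%n≡m%n b k n
  ModEq⇒%≡ {a = a} (k , inj₂ refl) = sym ([m+kn]%n≡m%n a k n)

  m%n≡p%n⇒[m+o]%n≡[p+o]%n : ∀ {m p} o → m % n ≡ p % n → (m + o) % n ≡ (p + o) % n
  m%n≡p%n⇒[m+o]%n≡[p+o]%n {m} {p} o m≡p = begin
    (m + o) % n            ≡⟨ %-distribˡ-+ m o n ⟩
    (m % n + o % n) % n    ≡⟨ cong (λ r → (r + o % n) % n) m≡p ⟩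
    (p % n + o % n) % n    ≡⟨ %-distribˡ-+ p o n ⟨
    (p + o) % n            ∎
    where open ≡-Reasoning

  -- Adding o·(n - 1) turns the common summand o into a multiple of n.
  [m+o]%n≡[p+o]%n⇒m%n≡p%n : ∀ {m p} o → (m + o) % n ≡ (p + o) % n → m % n ≡ p % n
  [m+o]%n≡[p+o]%n⇒m%n≡p%n {m} {p} o m+o≡p+o = begin
    m % n                      ≡⟨ absorb m ⟨
    (m + o + o * pred n) % n   ≡⟨ m%n≡p%n⇒[m+o]%n≡[p+o]%n (o * pred n) m+o≡p+o ⟩
    (p + o + o * pred n) % n   ≡⟨ absorb p ⟩
    p % n                      ∎
    where
    open ≡-Reasoning
    absorb : ∀ r → (r + o + o * pred n) % n ≡ r % n
    absorb r = begin
      (r + o + o * pred n) % n     ≡⟨ cong (_% n) (+-assoc r o _) ⟩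
      (r + (o + o * pred n)) % n   ≡⟨ cong (λ k → (r + k) % n) (*-suc o (pred n)) ⟨
      (r + o * suc (pred n)) % n   ≡⟨ cong (λ k → (r + o * k) % n) (suc-pred n) ⟩
      (r + o * n) % n              ≡⟨ [m+kn]%n≡m%n r o n ⟩
      r % n                        ∎

module _ {n : ℕ} .{{_ : NonZero n}} (m : ℕ) where

  -- Near ℓ x v : v ≡ x + d (mod n) for some d with -ℓm ≤ d ≤ ℓm, stored as D = d + ℓm.
  record Near (ℓ x v : ℕ) : Set where
    constructor near
    field
      offset     : ℕ
      offset≤    : offset ≤ ℓ * (m + m)
      congruence : (v + ℓ * m) % n ≡ (x + offset) % n

  near-refl : ∀ ℓ x → Near ℓ x x
  near-refl ℓ x = near (ℓ * m) (*-monoʳ-≤ ℓ (m≤m+n m m)) refl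

  near-step : ∀ {s ℓ x y v} → s ≤ m → ModEq n x (y + s) ⊎ ModEq n y (x + s) → Near ℓ y v → Near (suc ℓ) x v
  near-step {s} {ℓ} {x} {y} {v} s≤m (inj₁ x≡y+s) (near D D≤ v≈y+D) =
    near ((m ∸ s) + D) (+-mono-≤ (≤-trans (m∸n≤m m s) (m≤m+n m m)) D≤) (begin
      (v + (m + ℓ * m)) % n          ≡⟨ cong (_% n) (solve (v ∷ m ∷ ℓ ∷ [])) ⟩
      (v + ℓ * m + m) % n            ≡⟨ m%n≡p%n⇒[m+o]%n≡[p+o]%n m v≈y+D ⟩
      (y + D + m) % n                ≡⟨ cong (λ k → (y + D + k) % n) (m+[n∸m]≡n s≤m) ⟨
      (y + D + (s + (m ∸ s))) % n    ≡⟨ cong (_% n) (regroup (m ∸ s)) ⟩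
      (y + s + ((m ∸ s) + D)) % n    ≡⟨ m%n≡p%n⇒[m+o]%n≡[p+o]%n _ (ModEq⇒%≡ x≡y+s) ⟨
      (x + ((m ∸ s) + D)) % n        ∎)
    where
    open ≡-Reasoning
    regroup : ∀ t → y + D + (s + t) ≡ y + s + (t + D)
    regroup t = solve (y ∷ D ∷ s ∷ t ∷ [])
  near-step {s} {ℓ} {x} {y} {v} s≤m (inj₂ y≡x+s) (near D D≤ v≈y+D) =
    near ((s + m) + D) (+-mono-≤ (+-monoˡ-≤ m s≤m) D≤) (begin
      (v + (m + ℓ * m)) % n          ≡⟨ cong (_% n) (solve (v ∷ m ∷ ℓ ∷ [])) ⟩
      (v + ℓ * m + m) % n            ≡⟨ m%n≡p%n⇒[m+o]%n≡[p+o]%n m v≈y+D ⟩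
      (y + D + m) % n                ≡⟨ cong (_% n) (+-assoc y D m) ⟩
      (y + (D + m)) % n              ≡⟨ m%n≡p%n⇒[m+o]%n≡[p+o]%n _ (ModEq⇒%≡ y≡x+s) ⟩
      (x + s + (D + m)) % n          ≡⟨ cong (_% n) (solve (x ∷ s ∷ D ∷ m ∷ [])) ⟩
      (x + ((s + m) + D)) % n        ∎)
    where open ≡-Reasoning

  within⇒near : ∀ {S ℓ x v} → All (_≤ m) S → Within (CircAdj n S) ℓ x v → Near ℓ (toℕ x) (toℕ v)
  within⇒near {ℓ = ℓ} {x} _ here = near-refl ℓ (toℕ x)
  within⇒near S≤m (step (_ , edge) w) = uncurry near-step (lookupAny S≤m edge) (within⇒near S≤m w)

  burningSeq⇒n≤b[1+2bm] : ∀ {S b} {xs : Vec (Fin n) b} → All (_≤ m) S →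
                           IsBurningSeq (CircAdj n S) b xs → n ≤ b * suc (b * (m + m))
  burningSeq⇒n≤b[1+2bm] {S} {b} {xs} S≤m burn = injective⇒≤ label-injective
    where
    source : Fin n → Fin b
    source v = proj₁ (burn v)
    near-source : ∀ v → Near b (toℕ (lookup xs (source v))) (toℕ v)
    near-source v = within⇒near S≤m (within-mono (m∸n≤m b (suc (toℕ (source v)))) (proj₂ (burn v)))
    offset : Fin n → Fin (suc (b * (m + m)))
    offset v = fromℕ< (s≤s (Near.offset≤ (near-source v)))
    residue : Fin b → Fin (suc (b * (m + m))) → ℕ
    residue i D = (toℕ (lookup xs i) + toℕ D) % n
    near-residue : ∀ v → (toℕ v + b * m) % n ≡ residue (source v) (offset v)
    near-residue v = trans (Near.congruence (near-source v))
      (cong (λ D → (toℕ (lookup xs (source v)) + D) % n) (sym (toℕ-fromℕ< (s≤s (Near.offset≤ (near-source v))))))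
    label : Fin n → Fin (b * suc (b * (m + m)))
    label v = combine (source v) (offset v)
    label-injective : ∀ {v w} → label v ≡ label w → v ≡ w
    label-injective {v} {w} same-label = toℕ-injective (begin
      toℕ v        ≡⟨ m<n⇒m%n≡m (toℕ<n v) ⟨
      toℕ v % n    ≡⟨ [m+o]%n≡[p+o]%n⇒m%n≡p%n (b * m) same-residue ⟩
      toℕ w % n    ≡⟨ m<n⇒m%n≡m (toℕ<n w) ⟩
      toℕ w        ∎)
      where
      open ≡-Reasoning
      same-residue : (toℕ v + b * m) % n ≡ (toℕ w + b * m) % n
      same-residue = trans (near-residue v)
        (trans (uncurry (cong₂ residue) (combine-injective _ _ _ _ same-label)) (sym (near-residue w)))

b[1+2bm]≤3mb² : ∀ b m .{{_ : NonZero m}} → b * suc (b * (m + m)) ≤ 3 * (m * (b * b))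
b[1+2bm]≤3mb² b m = begin
  b * suc (b * (m + m))         ≡⟨ solve (b ∷ m ∷ []) ⟩
  b + 2 * (m * (b * b))         ≤⟨ +-monoˡ-≤ _ (b≤mb² b) ⟩
  m * (b * b) + 2 * (m * (b * b)) ≡⟨ solve (b ∷ m ∷ []) ⟩
  3 * (m * (b * b))             ∎
  where
  open ≤-Reasoning
  b≤mb² : ∀ k → k ≤ m * (k * k)
  b≤mb² zero      = z≤n
  b≤mb² k@(suc _) = ≤-trans (m≤m*n k k) (m≤n*m (k * k) m)

waypoint : ∀ {n} a {b} (y : Fin n) → toℕ y ≡ a + b → ∃ λ (z : Fin n) → toℕ z ≡ a × toℕ y ≡ toℕ z + b
waypoint a {b} y y≡a+b = fromℕ< a<n , toℕ-fromℕ< a<n , trans y≡a+b (cong (_+ b) (sym (toℕ-fromℕ< a<n)))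
  where
  a<n : a < _
  a<n = ≤-<-trans (≤-trans (m≤m+n a b) (≤-reflexive (sym y≡a+b))) (toℕ<n y)

module _ {n : ℕ} {S : List ℕ} {s : ℕ} (s∈S : s ∈ S) (0<s : 0 < s) where

  forward-adjacent : ∀ {x y : Fin n} → toℕ y ≡ toℕ x + s → CircAdj n S x y
  forward-adjacent {x} {y} y≡x+s = x≢y , Any.map (λ { refl → inj₂ (0 , inj₁ y≡x+s+0) }) s∈S
    where
    x≢y : x ≢ y
    x≢y x≡y = <⇒≢ (m<m+n (toℕ x) 0<s) (trans (cong toℕ x≡y) y≡x+s)
    y≡x+s+0 : toℕ y ≡ toℕ x + s + 0
    y≡x+s+0 = trans y≡x+s (sym (+-identityʳ _))

  forward-walk : ∀ j {x y : Fin n} → toℕ y ≡ toℕ x + j * s → Within (CircAdj n S) j x y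
  forward-walk zero {x} {y} y≡x+0 =
    subst (Within _ 0 x) (toℕ-injective (trans (sym (+-identityʳ (toℕ x))) (sym y≡x+0))) here
  forward-walk (suc j) {x} {y} y≡x+s+js
    with waypoint (toℕ x + s) y (trans y≡x+s+js (sym (+-assoc (toℕ x) s (j * s))))
  ... | z , z≡x+s , y≡z+js = step (forward-adjacent z≡x+s) (forward-walk j y≡z+js)

forward-walk₂ : ∀ {n S s t} → s ∈ S → 0 < s → t ∈ S → 0 < t → ∀ j k {x y : Fin n} →
                toℕ y ≡ toℕ x + (j * s + k * t) → Within (CircAdj n S) (j + k) x y
forward-walk₂ {s = s} {t} s∈S 0<s t∈S 0<t j k {x} {y} y≡x+js+kt
  with waypoint (toℕ x + j * s) y (trans y≡x+js+kt (sym (+-assoc (toℕ x) (j * s) (k * t))))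
... | z , z≡x+js , y≡z+kt = within-trans (forward-walk s∈S 0<s j z≡x+js) (forward-walk t∈S 0<t k y≡z+kt)

toℕ-remQuot : ∀ {k} l (i : Fin (k * l)) → toℕ i ≡ l * toℕ (quotient {k} l i) + toℕ (remainder {k} l i)
toℕ-remQuot {k} l i =
  trans (cong toℕ (sym (combine-remQuot {k} l i))) (toℕ-combine (quotient {k} l i) (remainder {k} l i))

mixed-radix : ∀ {q m} (w : Fin (q * (q * m))) →
              ∃ λ (i : Fin q) → ∃ λ (j : Fin q) → ∃ λ (a : Fin m) → toℕ w ≡ q * m * toℕ i + (toℕ j * m + toℕ a)
mixed-radix {q} {m} w = i , j , a , (begin
    toℕ w                               ≡⟨ toℕ-remQuot {q} (q * m) w ⟩
    q * m * toℕ i + toℕ r               ≡⟨ cong (q * m * toℕ i +_) (toℕ-remQuot {q} m r) ⟩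
    q * m * toℕ i + (m * toℕ j + toℕ a) ≡⟨ cong (λ k → q * m * toℕ i + (k + toℕ a)) (*-comm m (toℕ j)) ⟩
    q * m * toℕ i + (toℕ j * m + toℕ a) ∎)
  where
  open ≡-Reasoning
  i : Fin q
  i = quotient {q} (q * m) w
  r : Fin (q * m)
  r = remainder {q} (q * m) w
  j : Fin q
  j = quotient {q} m r
  a : Fin m
  a = remainder {q} m r

-- Only the first q entries (the centres i·qm) matter; the other q + m only lengthen the radii.
n≤q²m⇒burningSeq[q+[q+m]] : ∀ {n m q S} .{{_ : NonZero n}} → 0 < m → 1 ∈ S → m ∈ S → n ≤ q * (q * m) →
  ∃ λ (xs : Vec (Fin n) (q + (q + m))) → IsBurningSeq (CircAdj n S) (q + (q + m)) xs
n≤q²m⇒burningSeq[q+[q+m]] {n} {m} {q} {S} 0<m 1∈S m∈S n≤q²m = tabulate centre , cover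
  where
  centre : Fin (q + (q + m)) → Fin n
  centre i = (q * m * toℕ i) mod n
  cover : IsBurningSeq (CircAdj n S) (q + (q + m)) (tabulate centre)
  cover v with mixed-radix {q} {m} (inject≤ v n≤q²m)
  ... | i , j , a , w≡ = i ↑ˡ (q + m) , within-mono radius (forward-walk₂ m∈S 0<m 1∈S z<s (toℕ j) (toℕ a) v≡c+jm+a)
    where
    open ≤-Reasoning
    v≡ : toℕ v ≡ q * m * toℕ i + (toℕ j * m + toℕ a)
    v≡ = trans (sym (toℕ-inject≤ v n≤q²m)) w≡
    qmi<n : q * m * toℕ i < n
    qmi<n = ≤-<-trans (≤-trans (m≤m+n _ _) (≤-reflexive (sym v≡))) (toℕ<n v)
    centre≡ : toℕ (lookup (tabulate centre) (i ↑ˡ (q + m))) ≡ q * m * toℕ i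
    centre≡ = begin-equality
      toℕ (lookup (tabulate centre) (i ↑ˡ (q + m))) ≡⟨ cong toℕ (lookup∘tabulate centre (i ↑ˡ (q + m))) ⟩
      toℕ (centre (i ↑ˡ (q + m)))                   ≡⟨ toℕ-fromℕ< _ ⟩
      (q * m * toℕ (i ↑ˡ (q + m))) % n              ≡⟨ cong (λ k → (q * m * k) % n) (toℕ-↑ˡ i (q + m)) ⟩
      (q * m * toℕ i) % n                           ≡⟨ m<n⇒m%n≡m qmi<n ⟩
      q * m * toℕ i                                 ∎
    v≡c+jm+a : toℕ v ≡ toℕ (lookup (tabulate centre) (i ↑ˡ (q + m))) + (toℕ j * m + toℕ a * 1)
    v≡c+jm+a = trans v≡ (cong₂ _+_ (sym centre≡) (cong (toℕ j * m +_) (sym (*-identityʳ (toℕ a)))))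
    radius : toℕ j + toℕ a ≤ q + (q + m) ∸ suc (toℕ (i ↑ˡ (q + m)))
    radius = begin
      toℕ j + toℕ a                        ≤⟨ <⇒≤ (+-mono-< (toℕ<n j) (toℕ<n a)) ⟩
      q + m                                ≤⟨ m≤n+m (q + m) (q ∸ suc (toℕ i)) ⟩
      q ∸ suc (toℕ i) + (q + m)            ≡⟨ +-∸-comm (q + m) (toℕ<n i) ⟨
      q + (q + m) ∸ suc (toℕ i)            ≡⟨ cong (λ k → q + (q + m) ∸ suc k) (toℕ-↑ˡ i (q + m)) ⟨
      q + (q + m) ∸ suc (toℕ (i ↑ˡ (q + m))) ∎

square-bracket : ∀ m n .{{_ : NonZero m}} .{{_ : NonZero n}} → ∃ λ p → m * (p * p) < n × n ≤ m * (suc p * suc p)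
square-bracket m (suc zero) = 0 , subst (_< 1) (sym (*-zeroʳ m)) z<s , >-nonZero⁻¹ (m * 1) {{m*n≢0 m 1}}
square-bracket m (suc n@(suc _)) with square-bracket m n
... | p , mp²<n , n≤mq² with suc n ≤? m * (suc p * suc p)
...   | yes 1+n≤mq² = p , m<n⇒m<1+n mp²<n , 1+n≤mq²
...   | no  1+n≰mq² = suc p , ≰⇒> 1+n≰mq² , ≤-trans (s≤s n≤mq²) (*-monoʳ-< m (*-mono-< (n<1+n (suc p)) (n<1+n (suc p))))

m*m≤n*n⇒m≤n : ∀ {m n} → m * m ≤ n * n → m ≤ n
m*m≤n*n⇒m≤n m²≤n² = ≮⇒≥ (λ n<m → <⇒≱ (*-mono-< n<m n<m) m²≤n²)

burningNumber-lower : ∀ {m n b} .{{_ : NonZero m}} .{{_ : NonZero n}} →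
                      IsBurningNumber (CircAdj n (1 ∷ m ∷ [])) b → n ≤ 3 * (m * (b * b))
burningNumber-lower {m} {b = b} ((xs , burning) , _) =
  ≤-trans (burningSeq⇒n≤b[1+2bm] m {xs = xs} (>-nonZero⁻¹ m All.∷ ≤-refl All.∷ All.[]) burning) (b[1+2bm]≤3mb² b m)

1+p+[1+p+m]≤6p : ∀ {m} p → 1 ≤ p → m ≤ suc p → suc p + (suc p + m) ≤ 6 * p
1+p+[1+p+m]≤6p {m} p 1≤p m≤1+p = begin
  suc p + (suc p + m)         ≤⟨ +-mono-≤ 1+p≤2p (+-mono-≤ 1+p≤2p (≤-trans m≤1+p 1+p≤2p)) ⟩
  p + p + (p + p + (p + p))   ≡⟨ solve (p ∷ []) ⟩
  6 * p                       ∎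
  where
  open ≤-Reasoning
  1+p≤2p : suc p ≤ p + p
  1+p≤2p = +-monoˡ-≤ p 1≤p

b≤6p⇒mb²≤36mp² : ∀ {b} m p → b ≤ 6 * p → m * (b * b) ≤ 36 * (m * (p * p))
b≤6p⇒mb²≤36mp² {b} m p b≤6p = begin
  m * (b * b)               ≤⟨ *-monoʳ-≤ m (*-mono-≤ b≤6p b≤6p) ⟩
  m * (6 * p * (6 * p))     ≡⟨ solve (m ∷ p ∷ []) ⟩
  36 * (m * (p * p))        ∎
  where open ≤-Reasoning

burningNumber-upper : ∀ {m n b} .{{_ : NonZero m}} .{{_ : NonZero n}} → m * (m * m) ≤ n → 2 * m ≤ n →
                      IsBurningNumber (CircAdj n (1 ∷ m ∷ [])) b → m * (b * b) ≤ 36 * n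
burningNumber-upper {m} {n} {b} m³≤n 2m≤n (_ , minimal) with square-bracket m n
... | zero , _ , n≤m*1 = ⊥-elim (<⇒≱ (m<m*n m 2 (s≤s (s≤s z≤n))) m*2≤m)
  where
  open ≤-Reasoning
  m*2≤m : m * 2 ≤ m
  m*2≤m = begin
    m * 2   ≡⟨ *-comm m 2 ⟩
    2 * m   ≤⟨ 2m≤n ⟩
    n       ≤⟨ n≤m*1 ⟩
    m * 1   ≡⟨ *-identityʳ m ⟩
    m       ∎
... | p@(suc p′) , mp²<n , n≤m[1+p]² =
  ≤-trans (b≤6p⇒mb²≤36mp² m p (≤-trans b≤1+p+[1+p+m] (1+p+[1+p+m]≤6p p (s≤s z≤n) m≤1+p)))
          (*-monoʳ-≤ 36 (<⇒≤ mp²<n))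
  where
  b≤1+p+[1+p+m] : b ≤ suc p + (suc p + m)
  b≤1+p+[1+p+m] = ≮⇒≥ λ shorter → minimal _ shorter
    (n≤q²m⇒burningSeq[q+[q+m]] {q = suc p} (>-nonZero⁻¹ m) (here refl) (there (here refl))
      (≤-trans n≤m[1+p]² (≤-reflexive (solve (m ∷ p′ ∷ [])))))
  m≤1+p : m ≤ suc p
  m≤1+p = m*m≤n*n⇒m≤n (*-cancelˡ-≤ m (≤-trans m³≤n n≤m[1+p]²))

mainTheorem10 : ∃ λ (A : ℕ) → ∃ λ (B : ℕ) → 0 < A × 0 < B ×
    (∀ (m : ℕ) → 2 ≤ m → ∃ λ (N : ℕ) → ∀ (n : ℕ) → N ≤ n → 2 * m ≤ n →
      ∀ (b : ℕ) → IsBurningNumber (CircAdj n (1 ∷ m ∷ [])) b →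
        (n ≤ A * (m * (b * b))) × (m * (b * b) ≤ B * n))
mainTheorem10 = 3 , 36 , z<s , z<s , λ m 2≤m → m * (m * m) , bounds 2≤m
  where
  bounds : ∀ {m} → 2 ≤ m → ∀ n → m * (m * m) ≤ n → 2 * m ≤ n → ∀ b → IsBurningNumber (CircAdj n (1 ∷ m ∷ [])) b →
           n ≤ 3 * (m * (b * b)) × m * (b * b) ≤ 36 * n
  bounds {suc _} _ zero _ () _ _
  bounds {suc _} _ (suc _) m³≤n 2m≤n _ isBurning =
    burningNumber-lower isBurning , burningNumber-upper m³≤n 2m≤n isBurning
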